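{- Let $m\ge3$ be odd, let $c=2^{ -1}\bmod m=(m+1)/2$, and let $\tau^{(n)}$ be as defined in the context. For every $n\ge1$ and $(v_1,\dots,v_n)\in\{0,\dots,m-1\}^n$, the $n$-th coordinate $t_n$ of $\tau^{(n)}(v_1,\dots,v_n)$ is $$t_n=\Bigl(2^{ -(n-1)}v_n+\sum_{i=1}^{n-1}2^{ -i}v_i\Bigr)\bmod m,$$ where $2^{ -k}$ denotes the inverse of $2^k$ modulo $m$; so $t_n\equiv 2^{ -(n-1)}\widetilde{\widetilde v}_n\pmod m$ with $\widetilde{\widetilde v}_n=v_n+\sum_{i=1}^{n-1}2^{n-1-i}v_i$.
   Context: Fix an odd $m\ge3$ and $c=2^{ -1}\bmod m$. Define maps $\tau^{(n)}:\{0,\dots,m-1\}^n\to\{0,\dots,m-1\}^n$ recursively: $\tau^{(1)}$ is the identity, and for $n\ge2$, $\tau^{(n)}(v_1,\dots,v_n)=\bigl(v_1,\ \tau^{(n-1)}(c(v_1+v_2)\bmod m,\dots,c(v_1+v_n)\bmod m)\bigr)$. -}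

module Defs where

open import Data.Nat using (ℕ; zero; suc; _+_; _*_; _%_; _/_)
open import Data.Vec using (Vec; []; _∷_; map)

-- c = 2⁻¹ mod m = (m+1)/2 (for odd m, as in the paper)
half : ℕ → ℕ
half m = suc m / 2

τ : (m : ℕ) .{{_ : Data.Nat.NonZero m}} → {k : ℕ} → Vec ℕ (suc k) → Vec ℕ (suc k)
τ m {zero} (v ∷ []) = v ∷ []
τ m {suc k} (v ∷ vs) = v ∷ τ m (map (λ w → (half m * (v + w)) % m) vs)

-- Since c = (m+1)/2 inverts 2, doubling c(v₁ + vⱼ) mod m gives back v₁ + vⱼ. Inductively,
-- 2^(n-1) tₙ ≡ ṽṽₙ (mod m): one step of τ doubles the weights of v₂,…,vₙ and feeds v₁ in
-- with weight 2^(n-2) + … + 2 + 1 + 1 = 2^(n-1). Multiplying by 2^-(n-1) gives the second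
-- formula, and 2^-(n-1)·2^(n-1-i) ≡ 2^-i gives the first, which is an equality of naturals
-- because tₙ is already reduced mod m.

module Submission where

open import Defs
open import Data.Nat using (ℕ; zero; suc; _+_; _*_; _%_; _/_; _^_; _≤_; _<_; _∸_; NonZero; s≤s; z≤n)
open import Data.Nat.Properties using (+-identityʳ; *-identityˡ; *-identityʳ; *-assoc; *-comm; +-comm; ^-distribˡ-+-*; m∸n+n≡m)
open import Data.Nat.DivMod using (m≡m%n+[m/n]*n; m*n/n≡m; [m+kn]%n≡m%n; %-distribˡ-+; %-distribˡ-*; m%n%n≡m%n; m%n<n; m<n⇒m%n≡m)
open import Data.Nat.Divisibility using (_∣_; m%n≡0⇒n∣m)
open import Data.Nat.Solver using (module +-*-Solver)
open import Data.Fin using (Fin; toℕ; inject₁)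
open import Data.Vec using (Vec; []; _∷_; map; lookup; last; tabulate; sum)
open import Data.Vec.Relation.Unary.All using (All; []; _∷_; universal)
open import Data.Vec.Relation.Unary.All.Properties using (map⁺)
open import Data.Product using (_×_; _,_)
open import Relation.Nullary using (¬_; contradiction)
open import Relation.Binary.Bundles using (Setoid)
open import Relation.Binary.PropositionalEquality
  using (_≡_; refl; sym; trans; cong; cong₂; setoid; module ≡-Reasoning)
import Relation.Binary.Construct.On as On
import Relation.Binary.Reasoning.Setoid as SetoidReasoning
open import Level using (0ℓ)

open +-*-Solver using (solve; _:+_; _:*_; _:=_; con)

module Modular (m : ℕ) .{{_ : NonZero m}} where

  infix 4 _≈_
  _≈_ : ℕ → ℕ → Set
  a ≈ b = a % m ≡ b % m

  ≈-setoid : Setoid 0ℓ 0ℓ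
  ≈-setoid = On.setoid (setoid ℕ) (_% m)

  open SetoidReasoning ≈-setoid public

  +-cong : ∀ {a a′ b b′} → a ≈ a′ → b ≈ b′ → a + b ≈ a′ + b′
  +-cong {a} {a′} {b} {b′} a≈a′ b≈b′ = begin
    a + b              ≈⟨ %-distribˡ-+ a b m ⟩
    a % m + b % m      ≈⟨ cong₂ (λ u w → (u + w) % m) a≈a′ b≈b′ ⟩
    a′ % m + b′ % m    ≈⟨ %-distribˡ-+ a′ b′ m ⟨
    a′ + b′            ∎

  *-cong : ∀ {a a′ b b′} → a ≈ a′ → b ≈ b′ → a * b ≈ a′ * b′
  *-cong {a} {a′} {b} {b′} a≈a′ b≈b′ = begin
    a * b                ≈⟨ %-distribˡ-* a b m ⟩
    a % m * (b % m)      ≈⟨ cong₂ (λ u w → (u * w) % m) a≈a′ b≈b′ ⟩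
    a′ % m * (b′ % m)    ≈⟨ %-distribˡ-* a′ b′ m ⟨
    a′ * b′              ∎

  %-≈ : ∀ a → a % m ≈ a
  %-≈ a = m%n%n≡m%n a m

  inverse-unique : ∀ {a b e} → a * e ≈ 1 → b * e ≈ 1 → a ≈ b
  inverse-unique {a} {b} {e} ae≈1 be≈1 = begin
    a            ≡⟨ *-identityʳ a ⟨
    a * 1        ≈⟨ *-cong {a} refl be≈1 ⟨
    a * (b * e)  ≡⟨ solve 3 (λ a b e → a :* (b :* e) := b :* (a :* e)) refl a b e ⟩
    b * (a * e)  ≈⟨ *-cong {b} refl ae≈1 ⟩
    b * 1        ≡⟨ *-identityʳ b ⟩
    b            ∎

  cancel-inverse : ∀ {a e x y} → a * e ≈ 1 → e * x ≈ y → x ≈ a * y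
  cancel-inverse {a} {e} {x} {y} ae≈1 ex≈y = begin
    x            ≡⟨ *-identityˡ x ⟨
    1 * x        ≈⟨ *-cong ae≈1 refl ⟨
    a * e * x    ≡⟨ *-assoc a e x ⟩
    a * (e * x)  ≈⟨ *-cong {a} refl ex≈y ⟩
    a * y        ∎

  inverse-of-power : ∀ {a b e i k} → i ≤ k → a * e ^ k ≈ 1 → b * e ^ i ≈ 1 → b ≈ a * e ^ (k ∸ i)
  inverse-of-power {a} {b} {e} {i} {k} i≤k aeᵏ≈1 beⁱ≈1 = inverse-unique beⁱ≈1 (begin
    a * e ^ (k ∸ i) * e ^ i      ≡⟨ *-assoc a (e ^ (k ∸ i)) (e ^ i) ⟩
    a * (e ^ (k ∸ i) * e ^ i)    ≡⟨ cong (a *_) (^-distribˡ-+-* e (k ∸ i) i) ⟨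
    a * e ^ (k ∸ i + i)          ≡⟨ cong (λ n → a * e ^ n) (m∸n+n≡m i≤k) ⟩
    a * e ^ k                    ≈⟨ aeᵏ≈1 ⟩
    1                            ∎)

odd⇒%2≡1 : ∀ {n} → ¬ (2 ∣ n) → n % 2 ≡ 1
odd⇒%2≡1 {n} 2∤n with n % 2 | m%n<n n 2 | m%n≡0⇒n∣m n 2
... | zero        | _              | n%2≡0⇒2∣n = contradiction (n%2≡0⇒2∣n refl) 2∤n
... | suc zero    | _              | _         = refl
... | suc (suc _) | s≤s (s≤s ()) | _

2*half≡suc : ∀ {m} → ¬ (2 ∣ m) → 2 * half m ≡ suc m
2*half≡suc {m} 2∤m = begin
  2 * (suc m / 2)      ≡⟨ cong (λ n → 2 * (n / 2)) suc-m≡ ⟩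
  2 * (suc q * 2 / 2)  ≡⟨ cong (2 *_) (m*n/n≡m (suc q) 2) ⟩
  2 * suc q            ≡⟨ *-comm 2 (suc q) ⟩
  suc q * 2            ≡⟨ suc-m≡ ⟨
  suc m                ∎
  where
    open ≡-Reasoning
    q : ℕ
    q = m / 2
    suc-m≡ : suc m ≡ suc q * 2
    suc-m≡ = cong suc (trans (m≡m%n+[m/n]*n m 2) (cong (_+ q * 2) (odd⇒%2≡1 2∤m)))

-- The paper's ṽṽₙ; its last two entries both carry weight 1.
dyadicSum : {k : ℕ} → Vec ℕ (suc k) → ℕ
dyadicSum {zero}  (x ∷ [])  = x
dyadicSum {suc k} (x ∷ xs) = 2 ^ k * x + dyadicSum xs

linearForm : {k : ℕ} → (ℕ → ℕ) → ℕ → Vec ℕ (suc k) → ℕ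
linearForm {k} a b v = b * last v + sum (tabulate (λ (i : Fin k) → a (toℕ i) * lookup v (inject₁ i)))

linearForm-∷ : ∀ {k} (a : ℕ → ℕ) (b x : ℕ) (xs : Vec ℕ (suc k)) →
               linearForm a b (x ∷ xs) ≡ a 0 * x + linearForm (λ i → a (suc i)) b xs
linearForm-∷ a b x xs =
  solve 3 (λ l h t → l :+ (h :+ t) := h :+ (l :+ t)) refl (b * last xs) (a 0 * x) _

dyadicSum≡last+weighted : ∀ {k} (v : Vec ℕ (suc k)) →
  dyadicSum v ≡ last v + sum (tabulate (λ (i : Fin k) → 2 ^ (k ∸ suc (toℕ i)) * lookup v (inject₁ i)))
dyadicSum≡last+weighted {zero}  (x ∷ [])  = sym (+-identityʳ x)
dyadicSum≡last+weighted {suc k} (x ∷ xs) = begin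
  2 ^ k * x + dyadicSum xs        ≡⟨ cong (2 ^ k * x +_) (dyadicSum≡last+weighted xs) ⟩
  2 ^ k * x + (last xs + rest)    ≡⟨ solve 3 (λ h l r → h :+ (l :+ r) := l :+ (h :+ r)) refl (2 ^ k * x) (last xs) rest ⟩
  last xs + (2 ^ k * x + rest)    ∎
  where
    open ≡-Reasoning
    rest : ℕ
    rest = sum (tabulate (λ (i : Fin k) → 2 ^ (k ∸ suc (toℕ i)) * lookup xs (inject₁ i)))

module _ (m : ℕ) .{{_ : NonZero m}} where
  open Modular m

  *-dyadicSum≈linearForm : ∀ {k} (d : ℕ) (a : ℕ → ℕ) (b : ℕ) →
    (∀ i → i < k → a i ≈ d * 2 ^ (k ∸ suc i)) → b ≈ d →
    (v : Vec ℕ (suc k)) → d * dyadicSum v ≈ linearForm a b v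
  *-dyadicSum≈linearForm {zero} d a b _ b≈d (x ∷ []) = begin
    d * x        ≈⟨ *-cong (sym b≈d) refl ⟩
    b * x        ≡⟨ +-identityʳ (b * x) ⟨
    b * x + 0    ∎
  *-dyadicSum≈linearForm {suc k} d a b a≈ b≈d (x ∷ xs) = begin
    d * (2 ^ k * x + dyadicSum xs)                    ≡⟨ solve 4 (λ d p x s → d :* (p :* x :+ s) := d :* p :* x :+ d :* s) refl d (2 ^ k) x (dyadicSum xs) ⟩
    d * 2 ^ k * x + d * dyadicSum xs                  ≈⟨ +-cong (*-cong (sym (a≈ 0 (s≤s z≤n))) refl)
                                                                (*-dyadicSum≈linearForm d (λ i → a (suc i)) b (λ i i<k → a≈ (suc i) (s≤s i<k)) b≈d xs) ⟩
    a 0 * x + linearForm (λ i → a (suc i)) b xs       ≡⟨ linearForm-∷ a b x xs ⟨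
    linearForm a b (x ∷ xs)                           ∎

  mean : ℕ → ℕ → ℕ
  mean x w = (half m * (x + w)) % m

  last-τ< : ∀ {k} (v : Vec ℕ (suc k)) → All (λ x → suc x ≤ m) v → last (τ m v) < m
  last-τ< {zero}  (x ∷ []) (x<m ∷ []) = x<m
  last-τ< {suc k} (x ∷ xs) _          = last-τ< (map (mean x) xs) (map⁺ (universal (λ w → m%n<n _ m) xs))

  module _ (2∤m : ¬ (2 ∣ m)) where

    2*mean≈+ : ∀ x w → 2 * mean x w ≈ x + w
    2*mean≈+ x w = begin
      2 * ((half m * (x + w)) % m)  ≈⟨ *-cong {2} refl (%-≈ _) ⟩
      2 * (half m * (x + w))        ≡⟨ *-assoc 2 (half m) (x + w) ⟨
      2 * half m * (x + w)          ≡⟨ cong (_* (x + w)) (2*half≡suc 2∤m) ⟩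
      x + w + m * (x + w)           ≡⟨ cong (x + w +_) (*-comm m (x + w)) ⟩
      x + w + (x + w) * m           ≈⟨ [m+kn]%n≡m%n (x + w) (x + w) m ⟩
      x + w                         ∎

    2*dyadicSum-map-mean : ∀ x {n} (ys : Vec ℕ (suc n)) →
                           2 * dyadicSum (map (mean x) ys) ≈ dyadicSum ys + 2 ^ n * x
    2*dyadicSum-map-mean x {zero} (y ∷ []) = begin
      2 * mean x y      ≈⟨ 2*mean≈+ x y ⟩
      x + y             ≡⟨ solve 2 (λ x y → x :+ y := y :+ con 1 :* x) refl x y ⟩
      y + 1 * x         ∎
    2*dyadicSum-map-mean x {suc n} (y ∷ ys) = begin
      2 * (2 ^ n * mean x y + dyadicSum ws)             ≡⟨ solve 3 (λ p f s → con 2 :* (p :* f :+ s) := p :* (con 2 :* f) :+ con 2 :* s) refl (2 ^ n) (mean x y) (dyadicSum ws) ⟩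
      2 ^ n * (2 * mean x y) + 2 * dyadicSum ws         ≈⟨ +-cong (*-cong {2 ^ n} refl (2*mean≈+ x y)) (2*dyadicSum-map-mean x ys) ⟩
      2 ^ n * (x + y) + (dyadicSum ys + 2 ^ n * x)      ≡⟨ solve 4 (λ p x y s → p :* (x :+ y) :+ (s :+ p :* x) := (p :* y :+ s) :+ con 2 :* p :* x) refl (2 ^ n) x y (dyadicSum ys) ⟩
      2 ^ n * y + dyadicSum ys + 2 ^ suc n * x          ∎
      where
        ws : Vec ℕ (suc n)
        ws = map (mean x) ys

    2^k*last-τ≈dyadicSum : ∀ {k} (v : Vec ℕ (suc k)) → 2 ^ k * last (τ m v) ≈ dyadicSum v
    2^k*last-τ≈dyadicSum {zero}  (x ∷ [])  = cong (_% m) (*-identityˡ x)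
    2^k*last-τ≈dyadicSum {suc k} (x ∷ xs) = begin
      2 * 2 ^ k * last (τ m ws)     ≡⟨ *-assoc 2 (2 ^ k) _ ⟩
      2 * (2 ^ k * last (τ m ws))   ≈⟨ *-cong {2} refl (2^k*last-τ≈dyadicSum ws) ⟩
      2 * dyadicSum ws              ≈⟨ 2*dyadicSum-map-mean x xs ⟩
      dyadicSum xs + 2 ^ k * x      ≡⟨ +-comm (dyadicSum xs) (2 ^ k * x) ⟩
      2 ^ k * x + dyadicSum xs      ∎
      where
        ws : Vec ℕ (suc k)
        ws = map (mean x) xs

theorem8 : (m : ℕ) .{{_ : NonZero m}} → 3 ≤ m → ¬ (2 ∣ m) →
           (inv : ℕ → ℕ) → (∀ j → (inv j * 2 ^ j) % m ≡ 1 % m) →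
           (k : ℕ) (v : Vec ℕ (suc k)) → All (λ x → suc x ≤ m) v →
           (last (τ m v) ≡ (inv k * last v + sum (tabulate (λ (i : Fin k) → inv (suc (toℕ i)) * lookup v (inject₁ i)))) % m)
           × (last (τ m v) % m ≡ (inv k * (last v + sum (tabulate (λ (i : Fin k) → 2 ^ (k ∸ suc (toℕ i)) * lookup v (inject₁ i))))) % m)
theorem8 m _ 2∤m inv inv-spec k v v<m = first , second
  where
    open Modular m

    last-τ≈ : last (τ m v) ≈ inv k * dyadicSum v
    last-τ≈ = cancel-inverse {inv k} {2 ^ k} (inv-spec k) (2^k*last-τ≈dyadicSum m 2∤m v)

    first : last (τ m v) ≡ linearForm (λ i → inv (suc i)) (inv k) v % m
    first = trans (sym (m<n⇒m%n≡m (last-τ< m v v<m)))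
              (trans last-τ≈ (*-dyadicSum≈linearForm m (inv k) (λ i → inv (suc i)) (inv k)
                (λ i i<k → inverse-of-power {inv k} {inv (suc i)} {2} i<k (inv-spec k) (inv-spec (suc i))) refl v))

    second : last (τ m v) ≈ inv k * (last v + sum (tabulate (λ (i : Fin k) → 2 ^ (k ∸ suc (toℕ i)) * lookup v (inject₁ i))))
    second = trans last-τ≈ (cong (λ s → (inv k * s) % m) (dyadicSum≡last+weighted v))
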